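{- For every integer $n\ge 3$, $fw(1\,2\ldots n\;2\;1\;3\ldots n\;2)=4$.
   Context: Sequences are written as concatenations of letters. A sequence $s$ contains $u$ if some (not necessarily contiguous) subsequence of $s$ can be changed into $u$ by a one-to-one renaming of letters. An $(r,s)$-formation is a concatenation of $s$ permutations, each of the same set of $r$ distinct letters. The formation width $fw(u)$ is the minimum $s$ such that there exists $r$ for which every $(r,s)$-formation contains $u$. -}

module Defs where

open import Data.Nat using (ℕ; _+_; _∸_; _≤_)
open import Data.List using (List; []; _∷_; _++_; map; upTo; concat; length)
open import Data.List.Relation.Binary.Sublist.Propositional using (_⊆_)
open import Data.List.Relation.Binary.Permutation.Propositional using (_↭_)
open import Data.List.Relation.Unary.All using (All)
open import Data.List.Relation.Unary.Unique.Propositional using (Unique)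
open import Data.List.Membership.Propositional using (_∈_)
open import Data.Product using (Σ; ∃; _×_)
open import Relation.Binary.PropositionalEquality using (_≡_)

Seq : Set
Seq = List ℕ

Contains : Seq → Seq → Set
Contains s u =
  Σ Seq λ t → (t ⊆ s) ×
    Σ (ℕ → ℕ) λ φ →
      (∀ {x y} → x ∈ t → y ∈ t → φ x ≡ φ y → x ≡ y) × (map φ t ≡ u)

IsFormation : ℕ → ℕ → Seq → Set
IsFormation r s f =
  Σ Seq λ base → (length base ≡ r) × Unique base ×
    Σ (List Seq) λ blocks → (length blocks ≡ s) ×
      All (λ p → p ↭ base) blocks × (f ≡ concat blocks)

FwAdmissible : Seq → ℕ → Set
FwAdmissible u s = ∃ λ r → ∀ f → IsFormation r s f → Contains f u

FwIs : Seq → ℕ → Set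
FwIs u k = FwAdmissible u k × (∀ s → FwAdmissible u s → k ≤ s)

range : ℕ → ℕ → List ℕ
range a m = map (a +_) (upTo m)

pattern-u : ℕ → Seq
pattern-u n = range 1 n ++ (2 ∷ 1 ∷ []) ++ range 3 (n ∸ 2) ++ (2 ∷ [])

-- Upper bound: an Erdős–Szekeres argument, applied three times, yields n letters
-- that occur in the first permutation in some order S and in each of the other
-- three either as S or as S reversed.  Writing S = a b T z, whichever of blocks
-- 2–4 carry S reversed, the four blocks contain 1 2 … n 2 1 3 … n 2 under a
-- suitable relabelling of a, b, z and T.
-- Lower bound: u contains x y y x y, and the (r,3)-formation
-- (0 … r-1)(0 … r-1)(r-1 … 0) does not, since its three blocks are strictly
-- monotone; prefixes of it give formations with fewer blocks.
module Submission where

open import Defs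
open import Level using (Level; _⊔_)
open import Function.Base using (flip; id; _∘_)
open import Data.Empty using (⊥; ⊥-elim)
open import Data.Nat.Base using (ℕ; zero; suc; _+_; _≤_; _<_; _>_; s≤s; s≤s⁻¹)
open import Data.Nat.Properties
  using (_≟_; _≤?_; ≤-trans; ≤-reflexive; n≤1+n; ≰⇒>; +-monoˡ-≤; +-cancelˡ-≤;
         +-suc; +-identityʳ; suc-injective; <-irrefl; <-asym; m≤n⇒m⊓n≡m)
open import Data.Nat.GeneralisedArithmetic using (iterate)
open import Data.List.Base
  using (List; []; _∷_; _++_; map; length; reverse; concat; take; drop;
         upTo; applyUpTo; initLast; _∷ʳ′_)
open import Data.List.Properties
  using (map-++; map-applyUpTo; map-cong; map-cong-local; map-∘; ++-assoc; ++-identityʳ; ʳ++-defn;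
         reverse-++; length-take; length-upTo; take++drop≡id; concat-++)
open import Data.List.Membership.Propositional using (_∈_)
open import Data.List.Relation.Unary.Any using (here; there)
open import Data.List.Relation.Unary.All as All using (All; []; _∷_)
import Data.List.Relation.Unary.All.Properties as All
open import Data.List.Relation.Unary.AllPairs as AllPairs using (AllPairs; []; _∷_)
import Data.List.Relation.Unary.AllPairs.Properties as AllPairs
open import Data.List.Relation.Unary.Unique.Propositional using (Unique)
open import Data.List.Relation.Unary.Unique.Propositional.Properties using (upTo⁺)
open import Data.List.Relation.Binary.Sublist.Propositional
  using (_⊆_; []; _∷_; _∷ʳ_; ⊆-refl; ⊆-trans; minimum; from∈)
open import Data.List.Relation.Binary.Sublist.Propositional.Properties
  using (++⁺; ++⁺ˡ; ++⁺ʳ; reverse⁺; take-⊆; All-resp-⊆; Any-resp-⊆)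
open import Data.List.Relation.Binary.Permutation.Propositional
  using (_↭_; ↭-refl; ↭-sym; ↭-trans; prep; ↭⇒↭ₛ)
open import Data.List.Relation.Binary.Permutation.Propositional.Properties
  using (All-resp-↭; ∈-resp-↭; ↭-length; ↭-reverse; ∷↭∷ʳ)
import Data.List.Relation.Binary.Permutation.Setoid.Properties as PermutationSetoid
import Data.List.Relation.Binary.Pointwise as Pointwise
open import Data.List.Relation.Binary.Pointwise using ([]; _∷_; ≡⇒Pointwise-≡)
open import Data.Product.Base using (∃; _×_; _,_)
open import Data.Sum.Base using (_⊎_; inj₁; inj₂)
import Data.Sum.Base as Sum
open import Relation.Binary.Core using (Rel)
open import Relation.Binary.PropositionalEquality
  using (_≡_; _≢_; refl; sym; trans; cong; cong₂; subst; setoid; module ≡-Reasoning)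
open import Relation.Nullary using (¬_; yes; no)

private
  variable
    a ℓ : Level
    A : Set a
    k : ℕ
    w x y : A
    p q S T xs ys zs us vs ws : List A

AllPairs-resp-⊆ : {R : Rel A ℓ} → xs ⊆ ys → AllPairs R ys → AllPairs R xs
AllPairs-resp-⊆ []         []         = []
AllPairs-resp-⊆ (_ ∷ʳ s)   (_ ∷ pys)  = AllPairs-resp-⊆ s pys
AllPairs-resp-⊆ (refl ∷ s) (py ∷ pys) = All-resp-⊆ s py ∷ AllPairs-resp-⊆ s pys

AllPairs-map-within : {P : A → Set ℓ} {R S : Rel A ℓ} →
                      (∀ {x y} → P x → P y → R x y → S x y) →
                      All P xs → AllPairs R xs → AllPairs S xs
AllPairs-map-within f []         []         = []
AllPairs-map-within f (px ∷ pxs) (rx ∷ rxs) =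
  All.zipWith (λ (py , r) → f px py r) (pxs , rx) ∷ AllPairs-map-within f pxs rxs

All-reverse⁺ : {P : A → Set ℓ} → All P xs → All P (reverse xs)
All-reverse⁺ {xs = xs} = All-resp-↭ (↭-sym (↭-reverse xs))

AllPairs-reverse⁺ : {R : Rel A ℓ} → AllPairs R xs → AllPairs (flip R) (reverse xs)
AllPairs-reverse⁺ {xs = []}     []         = []
AllPairs-reverse⁺ {xs = x ∷ xs} (px ∷ pxs) rewrite ʳ++-defn xs {x ∷ []} =
  AllPairs.++⁺ (AllPairs-reverse⁺ pxs) ([] ∷ []) (All.map (_∷ []) (All-reverse⁺ px))

Unique-resp-↭ : xs ↭ ys → Unique xs → Unique ys
Unique-resp-↭ p = PermutationSetoid.Unique-resp-↭ (setoid _) (↭⇒↭ₛ p)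

++⁺-assoc : ∀ xs ys → xs ++ ys ⊆ us → zs ⊆ vs → xs ++ ys ++ zs ⊆ us ++ vs
++⁺-assoc xs ys s t = subst (_⊆ _) (++-assoc xs ys _) (++⁺ s t)

concat-take-⊆ : ∀ k (xss : List (List A)) → concat (take k xss) ⊆ concat xss
concat-take-⊆ k xss = subst (concat (take k xss) ⊆_) whole (++⁺ʳ (concat (drop k xss)) ⊆-refl)
  where
  whole : concat (take k xss) ++ concat (drop k xss) ≡ concat xss
  whole = trans (concat-++ (take k xss) _) (cong concat (take++drop≡id k xss))

split-⊆-++ : ws ⊆ xs ++ ys → ∃ λ k → take k ws ⊆ xs × drop k ws ⊆ ys
split-⊆-++ {xs = []}     s          = 0 , [] , s
split-⊆-++ {xs = x ∷ xs} (_ ∷ʳ s)   with split-⊆-++ s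
... | k , l , r = k , x ∷ʳ l , r
split-⊆-++ {xs = x ∷ xs} (refl ∷ s) with split-⊆-++ s
... | k , l , r = suc k , refl ∷ l , r

+-pigeonhole : ∀ {m n i j} → i + j ≤ m + n → i ≤ m ⊎ j ≤ n
+-pigeonhole {m} {n} {i} {j} le with i ≤? m
... | yes i≤m = inj₁ i≤m
... | no  i≰m = inj₂ (+-cancelˡ-≤ m j n
  (≤-trans (n≤1+n (m + j)) (≤-trans (+-monoˡ-≤ j (≰⇒> i≰m)) le)))

-- Erdős–Szekeres

Comparable : Rel A ℓ → Rel A ℓ
Comparable R x y = R x y ⊎ R y x

SubChain : Rel A ℓ → ℕ → List A → Set _
SubChain R k xs = ∃ λ ys → ys ⊆ xs × length ys ≡ k × AllPairs R ys

SubChain-∷ : {R : Rel A ℓ} → All (R x) ys → ys ⊆ xs → SubChain R k ys → SubChain R (suc k) (x ∷ xs)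
SubChain-∷ Rx ys⊆xs (zs , zs⊆ys , refl , chain) =
  _ ∷ zs , refl ∷ ⊆-trans zs⊆ys ys⊆xs , refl , All-resp-⊆ zs⊆ys Rx ∷ chain

SubChain-∷ʳ : {R : Rel A ℓ} → ys ⊆ xs → SubChain R k ys → SubChain R k (x ∷ xs)
SubChain-∷ʳ ys⊆xs (zs , zs⊆ys , len , chain) = zs , _ ∷ʳ ⊆-trans zs⊆ys ys⊆xs , len , chain

esBound : ℕ → ℕ → ℕ
esBound zero    _       = 0
esBound (suc _) zero    = 0
esBound (suc i) (suc j) = suc (esBound i (suc j) + esBound (suc i) j)

esDiagonal : ℕ → ℕ
esDiagonal k = esBound k k

module _ {A : Set a} {R : Rel A ℓ} where

  record Partition (x : A) (xs : List A) : Set (a ⊔ ℓ) where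
    field
      above below : List A
      above⊆      : above ⊆ xs
      below⊆      : below ⊆ xs
      size        : length above + length below ≡ length xs
      above-R     : All (R x) above
      below-R     : All (flip R x) below

  partition : All (Comparable R x) xs → Partition x xs
  partition [] = record
    { above = [] ; below = [] ; above⊆ = [] ; below⊆ = [] ; size = refl ; above-R = [] ; below-R = [] }
  partition {xs = y ∷ _} (inj₁ xRy ∷ cmp) = let open Partition (partition cmp) in record
    { above = y ∷ above ; below = below ; above⊆ = refl ∷ above⊆ ; below⊆ = y ∷ʳ below⊆
    ; size = cong suc size ; above-R = xRy ∷ above-R ; below-R = below-R }
  partition {xs = y ∷ _} (inj₂ yRx ∷ cmp) = let open Partition (partition cmp) in record
    { above = above ; below = y ∷ below ; above⊆ = y ∷ʳ above⊆ ; below⊆ = refl ∷ below⊆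
    ; size = trans (+-suc (length above) (length below)) (cong suc size)
    ; above-R = above-R ; below-R = yRx ∷ below-R }

  erdős-szekeres : ∀ i j → AllPairs (Comparable R) xs → esBound i j ≤ length xs →
                   SubChain R i xs ⊎ SubChain (flip R) j xs
  erdős-szekeres zero    _       _ _ = inj₁ ([] , minimum _ , refl , [])
  erdős-szekeres (suc i) zero    _ _ = inj₂ ([] , minimum _ , refl , [])
  erdős-szekeres {xs = x ∷ xs} (suc i) (suc j) (cmp ∷ cmps) (s≤s bound)
    with partition cmp
  ... | P with +-pigeonhole (subst (_ ≤_) (sym (Partition.size P)) bound)
  ... | inj₁ big = Sum.map (SubChain-∷ above-R above⊆) (SubChain-∷ʳ above⊆)
                     (erdős-szekeres i (suc j) (AllPairs-resp-⊆ above⊆ cmps) big)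
    where open Partition P
  ... | inj₂ big = Sum.map (SubChain-∷ʳ below⊆) (SubChain-∷ below-R below⊆)
                     (erdős-szekeres (suc i) j (AllPairs-resp-⊆ below⊆ cmps) big)
    where open Partition P

Before : List A → Rel A _
Before q x y = x ∷ y ∷ [] ⊆ q

before-comparable : x ≢ y → x ∈ q → y ∈ q → Comparable (Before q) x y
before-comparable x≢y (here refl) (here refl) = ⊥-elim (x≢y refl)
before-comparable _   (here refl) (there y∈) = inj₁ (refl ∷ from∈ y∈)
before-comparable _   (there x∈)  (here refl) = inj₂ (refl ∷ from∈ x∈)
before-comparable x≢y (there x∈)  (there y∈) =
  Sum.map (_ ∷ʳ_) (_ ∷ʳ_) (before-comparable x≢y x∈ y∈)

Unique⇒comparable : Unique xs → All (_∈ q) xs → AllPairs (Comparable (Before q)) xs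
Unique⇒comparable []           []           = []
Unique⇒comparable (x≢xs ∷ uxs) (x∈ ∷ xs∈) =
  All.zipWith (λ (x≢y , y∈) → before-comparable x≢y x∈ y∈) (x≢xs , xs∈) ∷ Unique⇒comparable uxs xs∈

Before-∷⇒∈ : Before (w ∷ q) x y → y ∈ q
Before-∷⇒∈ (refl ∷ s) = Any-resp-⊆ s (here refl)
Before-∷⇒∈ (_ ∷ʳ s)   = Any-resp-⊆ s (there (here refl))

Before-∷⁻ : x ≢ w → Before (w ∷ q) x y → Before q x y
Before-∷⁻ x≢w (refl ∷ _) = ⊥-elim (x≢w refl)
Before-∷⁻ _   (_ ∷ʳ s)   = s

Before-∷-tail : Unique (w ∷ q) → All (_∈ q) zs → AllPairs (Before (w ∷ q)) zs → AllPairs (Before q) zs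
Before-∷-tail (w∉q ∷ _) =
  AllPairs-map-within (λ x∈q _ → Before-∷⁻ λ { refl → All.lookup w∉q x∈q refl })

sorted⇒⊆ : Unique q → All (_∈ q) ys → AllPairs (Before q) ys → ys ⊆ q
sorted⇒⊆ _ [] [] = minimum _
sorted⇒⊆ uwq@(_ ∷ uq) (here refl ∷ _) (w≺ys ∷ sorted) =
  refl ∷ sorted⇒⊆ uq ys∈q (Before-∷-tail uwq ys∈q sorted)
  where ys∈q = All.map Before-∷⇒∈ w≺ys
sorted⇒⊆ uwq@(_ ∷ uq) (there y∈q ∷ _) (y≺ys ∷ sorted) =
  _ ∷ʳ sorted⇒⊆ uq ys∈q (Before-∷-tail uwq ys∈q (y≺ys ∷ sorted))
  where ys∈q = y∈q ∷ All.map Before-∷⇒∈ y≺ys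

Oriented : List A → List A → Set _
Oriented q S = S ⊆ q ⊎ reverse S ⊆ q

Oriented-resp-⊆ : T ⊆ S → Oriented q S → Oriented q T
Oriented-resp-⊆ T⊆S = Sum.map (⊆-trans T⊆S) (⊆-trans (reverse⁺ T⊆S))

oriented-subsequence : Unique q → Unique xs → All (_∈ q) xs → esDiagonal k ≤ length xs →
                       ∃ λ S → S ⊆ xs × length S ≡ k × Oriented q S
oriented-subsequence {k = k} uq uxs xs∈q bound
  with erdős-szekeres k k (Unique⇒comparable uxs xs∈q) bound
... | inj₁ (S , S⊆xs , len , increasing) =
  S , S⊆xs , len , inj₁ (sorted⇒⊆ uq (All-resp-⊆ S⊆xs xs∈q) increasing)
... | inj₂ (S , S⊆xs , len , decreasing) =
  S , S⊆xs , len , inj₂ (sorted⇒⊆ uq (All-reverse⁺ (All-resp-⊆ S⊆xs xs∈q)) (AllPairs-reverse⁺ decreasing))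

common-orientation : ∀ qs k → Unique p → All (_↭ p) qs → iterate esDiagonal k (length qs) ≤ length p →
                     ∃ λ S → S ⊆ p × length S ≡ k × All (λ q → Oriented q S) qs
common-orientation {p = p} [] k _ [] bound =
  take k p , take-⊆ k p , trans (length-take k p) (m≤n⇒m⊓n≡m bound) , []
common-orientation (q ∷ qs) k up (q↭p ∷ qs↭p) bound
  with common-orientation qs (esDiagonal k) up qs↭p bound
... | S′ , S′⊆p , |S′| , oriented
  with oriented-subsequence (Unique-resp-↭ (↭-sym q↭p) up) (AllPairs-resp-⊆ S′⊆p up)
         (All.tabulate (∈-resp-↭ (↭-sym q↭p) ∘ Any-resp-⊆ S′⊆p)) (≤-reflexive (sym |S′|))
... | S , S⊆S′ , |S| , o = S , ⊆-trans S⊆S′ S′⊆p , |S| , o ∷ All.map (Oriented-resp-⊆ S⊆S′) oriented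

range-suc : ∀ c k → range c (suc k) ≡ c ∷ range (suc c) k
range-suc c k = cong₂ _∷_ (+-identityʳ c) (begin
  map (c +_) (applyUpTo suc k)   ≡⟨ cong (map (c +_)) (map-applyUpTo id suc k) ⟨
  map (c +_) (map suc (upTo k))  ≡⟨ map-∘ (upTo k) ⟨
  map ((c +_) ∘ suc) (upTo k)    ≡⟨ map-cong (+-suc c) (upTo k) ⟩
  map (suc c +_) (upTo k)        ∎)
  where open ≡-Reasoning

indexOf : ℕ → List ℕ → ℕ
indexOf x [] = 0
indexOf x (w ∷ ws) with x ≟ w
... | yes _ = 0
... | no  _ = suc (indexOf x ws)

indexOf-here : ∀ w ws → indexOf w (w ∷ ws) ≡ 0
indexOf-here w ws with w ≟ w
... | yes _   = refl
... | no  w≢w = ⊥-elim (w≢w refl)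

indexOf-there : ∀ {x w} ws → x ≢ w → indexOf x (w ∷ ws) ≡ suc (indexOf x ws)
indexOf-there {x} {w} ws x≢w with x ≟ w
... | yes x≡w = ⊥-elim (x≢w x≡w)
... | no  _   = refl

indexOf-injective : ∀ {x y ws} → x ∈ ws → y ∈ ws → indexOf x ws ≡ indexOf y ws → x ≡ y
indexOf-injective {x} {y} {w ∷ ws} x∈ y∈ eq with x ≟ w | y ≟ w
... | yes x≡w | yes y≡w = trans x≡w (sym y≡w)
indexOf-injective (here x≡w)  _           eq | no x≢w | _      = ⊥-elim (x≢w x≡w)
indexOf-injective (there _)   (here y≡w)  eq | no _   | no y≢w = ⊥-elim (y≢w y≡w)
indexOf-injective (there x∈)  (there y∈)  eq | no _   | no _   = indexOf-injective x∈ y∈ (suc-injective eq)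

map-indexOf : ∀ c {ws} → Unique ws → map (λ w → c + indexOf w ws) ws ≡ range c (length ws)
map-indexOf c {[]}     []           = refl
map-indexOf c {d ∷ ds} (d≢ds ∷ uds) = begin
  c + indexOf d (d ∷ ds) ∷ map (λ w → c + indexOf w (d ∷ ds)) ds
    ≡⟨ cong₂ _∷_ (trans (cong (c +_) (indexOf-here d ds)) (+-identityʳ c))
                 (map-cong-local (All.map shift d≢ds)) ⟩
  c ∷ map (λ w → suc c + indexOf w ds) ds
    ≡⟨ cong (c ∷_) (map-indexOf (suc c) uds) ⟩
  c ∷ range (suc c) (length ds)
    ≡⟨ range-suc c (length ds) ⟨
  range c (suc (length ds)) ∎
  where
  open ≡-Reasoning
  shift : ∀ {w} → d ≢ w → c + indexOf w (d ∷ ds) ≡ suc c + indexOf w ds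
  shift d≢w = trans (cong (c +_) (indexOf-there ds (d≢w ∘ sym))) (+-suc c _)

patternWord : ℕ → ℕ → List ℕ → List ℕ
patternWord a b M = a ∷ b ∷ M ++ b ∷ a ∷ M ++ b ∷ []

patternWord-cong : ∀ {a b a′ b′ : ℕ} {M M′ : List ℕ} →
                   _≡_ {A = List ℕ} (a ∷ b ∷ M) (a′ ∷ b′ ∷ M′) → patternWord a b M ≡ patternWord a′ b′ M′
patternWord-cong refl = refl

map-patternWord : ∀ (f : ℕ → ℕ) a b M → map f (patternWord a b M) ≡ patternWord (f a) (f b) (map f M)
map-patternWord f a b M = cong (λ ys → f a ∷ f b ∷ ys)
  (trans (map-++ f M _) (cong (λ ys → map f M ++ f b ∷ f a ∷ ys) (map-++ f M _)))

range-2+ : ∀ c k → range c (2 + k) ≡ c ∷ suc c ∷ range (2 + c) k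
range-2+ c k = trans (range-suc c (suc k)) (cong (c ∷_) (range-suc (suc c) k))

pattern-u≡patternWord : ∀ k → pattern-u (2 + k) ≡ patternWord 1 2 (range 3 k)
pattern-u≡patternWord k = cong (_++ 2 ∷ 1 ∷ range 3 k ++ 2 ∷ []) (range-2+ 1 k)

patternWord-contains-pattern-u : ∀ {f a b M} → S ↭ a ∷ b ∷ M → Unique S → patternWord a b M ⊆ f →
                                 Contains f (pattern-u (length S))
patternWord-contains-pattern-u {S = S} {f} {a} {b} {M} S↭D uS sub =
  patternWord a b M , sub , φ , injective , relabel
  where
  D = a ∷ b ∷ M
  φ : ℕ → ℕ
  φ w = 1 + indexOf w D
  uD : Unique D
  uD = Unique-resp-↭ S↭D uS
  M∈D : All (_∈ D) M
  M∈D = All.tabulate (there ∘ there)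
  word∈D : All (_∈ D) (patternWord a b M)
  word∈D = here refl ∷ there (here refl) ∷
           All.++⁺ M∈D (there (here refl) ∷ here refl ∷ All.++⁺ M∈D (there (here refl) ∷ []))
  φ-on-D : map φ D ≡ 1 ∷ 2 ∷ range 3 (length M)
  φ-on-D = trans (map-indexOf 1 uD) (range-2+ 1 (length M))
  injective : ∀ {x y} → x ∈ patternWord a b M → y ∈ patternWord a b M → φ x ≡ φ y → x ≡ y
  injective x∈ y∈ eq = indexOf-injective (All.lookup word∈D x∈) (All.lookup word∈D y∈) (suc-injective eq)
  relabel : map φ (patternWord a b M) ≡ pattern-u (length S)
  relabel = begin
    map φ (patternWord a b M)            ≡⟨ map-patternWord φ a b M ⟩
    patternWord (φ a) (φ b) (map φ M)    ≡⟨ patternWord-cong φ-on-D ⟩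
    patternWord 1 2 (range 3 (length M)) ≡⟨ pattern-u≡patternWord (length M) ⟨
    pattern-u (length D)                 ≡⟨ cong pattern-u (↭-length S↭D) ⟨
    pattern-u (length S)                 ∎
    where open ≡-Reasoning

-- Upper bound

reverse-∷-∷-∷ʳ : ∀ (a b : ℕ) T z → reverse (a ∷ b ∷ T ++ z ∷ []) ≡ z ∷ reverse T ++ b ∷ a ∷ []
reverse-∷-∷-∷ʳ a b T z = trans (reverse-++ (a ∷ b ∷ T) (z ∷ [])) (cong (z ∷_) (ʳ++-defn T))

module FourBlocks {a b z : ℕ} {T p₁ p₂ p₃ p₄ : List ℕ}
                  (u-abTz : Unique (a ∷ b ∷ T ++ z ∷ [])) (abTz⊆p₁ : a ∷ b ∷ T ++ z ∷ [] ⊆ p₁) where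

  abTz : List ℕ
  abTz = a ∷ b ∷ T ++ z ∷ []

  ContainsPattern : Set
  ContainsPattern = Contains (concat (p₁ ∷ p₂ ∷ p₃ ∷ p₄ ∷ [])) (pattern-u (length abTz))

  singleton : x ∈ abTz → Oriented q abTz → x ∷ [] ⊆ q
  singleton x∈abTz = Sum.[ id , id ] ∘ Oriented-resp-⊆ (from∈ x∈abTz)

  -- Blocks 1–4 supply  a b T z | b | a T z | b.
  via-abTz : b ∷ [] ⊆ p₂ → abTz ⊆ p₃ → b ∷ [] ⊆ p₄ → ContainsPattern
  via-abTz b⊆p₂ abTz⊆p₃ b⊆p₄ = patternWord-contains-pattern-u ↭-refl u-abTz
    (++⁺ abTz⊆p₁ (++⁺ b⊆p₂ (++⁺ (⊆-trans (refl ∷ b ∷ʳ ⊆-refl) abTz⊆p₃) (++⁺ b⊆p₄ []))))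

  -- Blocks 1–4 supply  a z | b T z | a | b T z.
  via-azbT : abTz ⊆ p₂ → a ∷ [] ⊆ p₃ → abTz ⊆ p₄ → ContainsPattern
  via-azbT abTz⊆p₂ a⊆p₃ abTz⊆p₄ =
    patternWord-contains-pattern-u (prep a (↭-sym (∷↭∷ʳ z (b ∷ T)))) u-abTz
      (++⁺ (⊆-trans az⊆abTz abTz⊆p₁)
        (++⁺-assoc (b ∷ T) (z ∷ []) (⊆-trans bTz⊆abTz abTz⊆p₂)
          (++⁺ a⊆p₃
            (++⁺-assoc (b ∷ T) (z ∷ []) (⊆-trans bTz⊆abTz abTz⊆p₄) []))))
    where
    az⊆abTz : a ∷ z ∷ [] ⊆ abTz
    az⊆abTz = refl ∷ b ∷ʳ ++⁺ˡ T ⊆-refl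
    bTz⊆abTz : b ∷ T ++ z ∷ [] ⊆ abTz
    bTz⊆abTz = a ∷ʳ ⊆-refl

  abz⊆p₁ : a ∷ b ∷ z ∷ [] ⊆ p₁
  abz⊆p₁ = ⊆-trans (refl ∷ refl ∷ ++⁺ˡ T ⊆-refl) abTz⊆p₁

  abTz↭abzR : abTz ↭ a ∷ b ∷ z ∷ reverse T
  abTz↭abzR = prep a (prep b (↭-trans (↭-sym (∷↭∷ʳ z T)) (prep z (↭-sym (↭-reverse T)))))

  Rba⊆reverse : reverse T ++ b ∷ a ∷ [] ⊆ reverse abTz
  Rba⊆reverse = subst (_ ⊆_) (sym (reverse-∷-∷-∷ʳ a b T z)) (z ∷ʳ ⊆-refl)

  zRb⊆reverse : (z ∷ reverse T) ++ b ∷ [] ⊆ reverse abTz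
  zRb⊆reverse = subst (_ ⊆_) (sym (reverse-∷-∷-∷ʳ a b T z)) (refl ∷ ++⁺ ⊆-refl (refl ∷ a ∷ʳ []))

  -- With R = reverse T, two consecutive reversed blocks after block 1 supply
  -- a b z | R b a | z R b.
  via-abzR₂₃ : reverse abTz ⊆ p₂ → reverse abTz ⊆ p₃ → ContainsPattern
  via-abzR₂₃ r₂ r₃ = patternWord-contains-pattern-u abTz↭abzR u-abTz
    (++⁺ abz⊆p₁
      (++⁺-assoc (reverse T) (b ∷ a ∷ []) (⊆-trans Rba⊆reverse r₂)
        (++⁺-assoc (z ∷ reverse T) (b ∷ []) (⊆-trans zRb⊆reverse r₃) (minimum _))))

  via-abzR₃₄ : reverse abTz ⊆ p₃ → reverse abTz ⊆ p₄ → ContainsPattern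
  via-abzR₃₄ r₃ r₄ = patternWord-contains-pattern-u abTz↭abzR u-abTz
    (++⁺ abz⊆p₁ (++⁺ (minimum p₂)
      (++⁺-assoc (reverse T) (b ∷ a ∷ []) (⊆-trans Rba⊆reverse r₃)
        (++⁺-assoc (z ∷ reverse T) (b ∷ []) (⊆-trans zRb⊆reverse r₄) []))))

  four-blocks : Oriented p₂ abTz → Oriented p₃ abTz → Oriented p₄ abTz → ContainsPattern
  four-blocks o₂        (inj₁ s₃)   o₄        = via-abTz (singleton (there (here refl)) o₂) s₃
                                                         (singleton (there (here refl)) o₄)
  four-blocks (inj₂ r₂) (inj₂ r₃)   _         = via-abzR₂₃ r₂ r₃
  four-blocks (inj₁ _)  (inj₂ r₃)   (inj₂ r₄) = via-abzR₃₄ r₃ r₄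
  four-blocks (inj₁ s₂) o₃@(inj₂ _) (inj₁ s₄) = via-azbT s₂ (singleton (here refl) o₃) s₄

oriented-contains : ∀ {p₁ p₂ p₃ p₄} → 3 ≤ length S → Unique S → S ⊆ p₁ →
                    Oriented p₂ S → Oriented p₃ S → Oriented p₄ S →
                    Contains (concat (p₁ ∷ p₂ ∷ p₃ ∷ p₄ ∷ [])) (pattern-u (length S))
oriented-contains {S = _ ∷ []} (s≤s ())
oriented-contains {S = a ∷ b ∷ T} 3≤|S| uS S⊆p₁ with initLast T | 3≤|S|
... | []       | s≤s (s≤s ())
... | _ ∷ʳ′ _  | _ = FourBlocks.four-blocks uS S⊆p₁

four-permutations-contain : ∀ n {p q₂ q₃ q₄} → 3 ≤ n → Unique p → All (_↭ p) (q₂ ∷ q₃ ∷ q₄ ∷ []) →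
                            iterate esDiagonal n 3 ≤ length p →
                            Contains (concat (p ∷ q₂ ∷ q₃ ∷ q₄ ∷ [])) (pattern-u n)
four-permutations-contain n 3≤n up qs↭p bound with common-orientation _ n up qs↭p bound
... | S , S⊆p , refl , o₂ ∷ o₃ ∷ o₄ ∷ [] = oriented-contains 3≤n (AllPairs-resp-⊆ S⊆p up) S⊆p o₂ o₃ o₄

fw-upper : ∀ n → 3 ≤ n → FwAdmissible (pattern-u n) 4
fw-upper n 3≤n = iterate esDiagonal n 3 , λ where
  _ (base , |base| , ubase , p ∷ q₂ ∷ q₃ ∷ q₄ ∷ [] , refl , p↭base ∷ qs↭base , refl) →
    four-permutations-contain n 3≤n (Unique-resp-↭ (↭-sym p↭base) ubase)
      (All.map (λ q↭base → ↭-trans q↭base (↭-sym p↭base)) qs↭base)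
      (≤-reflexive (sym (trans (↭-length p↭base) |base|)))

-- Lower bound

Contains-⊆ˡ : ∀ {f g u} → f ⊆ g → Contains f u → Contains g u
Contains-⊆ˡ f⊆g (t , t⊆f , rest) = t , ⊆-trans t⊆f f⊆g , rest

map-⊆⁻ : ∀ {B : Set ℓ} (φ : A → B) {v} t → v ⊆ map φ t → ∃ λ t′ → t′ ⊆ t × map φ t′ ≡ v
map-⊆⁻ φ []      []         = [] , [] , refl
map-⊆⁻ φ (w ∷ t) (_ ∷ʳ s)   with map-⊆⁻ φ t s
... | t′ , t′⊆t , eq = t′ , w ∷ʳ t′⊆t , eq
map-⊆⁻ φ (w ∷ t) (refl ∷ s) with map-⊆⁻ φ t s
... | t′ , t′⊆t , eq = w ∷ t′ , refl ∷ t′⊆t , cong (φ w ∷_) eq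

Contains-⊆ʳ : ∀ {f u v} → v ⊆ u → Contains f u → Contains f v
Contains-⊆ʳ v⊆u (t , t⊆f , φ , injective , refl) with map-⊆⁻ φ t v⊆u
... | t′ , t′⊆t , eq =
  t′ , ⊆-trans t′⊆t t⊆f , φ , (λ x∈ y∈ → injective (Any-resp-⊆ t′⊆t x∈) (Any-resp-⊆ t′⊆t y∈)) , eq

xyyxy⊆patternWord : ∀ a b M → a ∷ b ∷ b ∷ a ∷ b ∷ [] ⊆ patternWord a b M
xyyxy⊆patternWord a b M = refl ∷ refl ∷ ++⁺ˡ M (refl ∷ refl ∷ ++⁺ˡ M ⊆-refl)

contains-xyyxy : ∀ {f} → Contains f (1 ∷ 2 ∷ 2 ∷ 1 ∷ 2 ∷ []) → ∃ λ x → ∃ λ y → x ∷ y ∷ y ∷ x ∷ y ∷ [] ⊆ f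
contains-xyyxy (t , t⊆f , φ , injective , eq) with Pointwise.map⁻ φ id (≡⇒Pointwise-≡ eq)
contains-xyyxy (x ∷ y ∷ y′ ∷ x′ ∷ y″ ∷ [] , t⊆f , φ , injective , eq) | φx ∷ φy ∷ φy′ ∷ φx′ ∷ φy″ ∷ [] =
  x , y , collapse
    (injective (there (there (here refl))) (there (here refl)) (trans φy′ (sym φy)))
    (injective (there (there (there (here refl)))) (here refl) (trans φx′ (sym φx)))
    (injective (there (there (there (there (here refl))))) (there (here refl)) (trans φy″ (sym φy)))
  where
  collapse : y′ ≡ y → x′ ≡ x → y″ ≡ y → x ∷ y ∷ y ∷ x ∷ y ∷ [] ⊆ _
  collapse refl refl refl = t⊆f

xyyxy⊆pattern-u : ∀ k → 1 ∷ 2 ∷ 2 ∷ 1 ∷ 2 ∷ [] ⊆ pattern-u (2 + k)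
xyyxy⊆pattern-u k =
  subst (1 ∷ 2 ∷ 2 ∷ 1 ∷ 2 ∷ [] ⊆_) (sym (pattern-u≡patternWord k)) (xyyxy⊆patternWord 1 2 (range 3 k))

-- Each cut either puts two y's into one strictly monotone block or forces x < y < x.
xyyxy-monotone-split : ∀ {x y : ℕ} k l → let w = x ∷ y ∷ y ∷ x ∷ y ∷ [] in
                       AllPairs _<_ (take k w) → AllPairs _<_ (take l (drop k w)) →
                       AllPairs _>_ (drop l (drop k w)) → ⊥
xyyxy-monotone-split (suc (suc (suc _))) _ (_ ∷ (y<y ∷ _) ∷ _) _ _ = <-irrefl refl y<y
xyyxy-monotone-split 0 0                   _ _ (_ ∷ (y>y ∷ _) ∷ _)      = <-irrefl refl y>y
xyyxy-monotone-split 0 1                   _ _ ((y>y ∷ _) ∷ _)          = <-irrefl refl y>y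
xyyxy-monotone-split 0 2                   _ _ ((_ ∷ y>y ∷ _) ∷ _)      = <-irrefl refl y>y
xyyxy-monotone-split 0 (suc (suc (suc _))) _ (_ ∷ (y<y ∷ _) ∷ _) _      = <-irrefl refl y<y
xyyxy-monotone-split 1 0                   _ _ ((y>y ∷ _) ∷ _)          = <-irrefl refl y>y
xyyxy-monotone-split 1 1                   _ _ ((_ ∷ y>y ∷ _) ∷ _)      = <-irrefl refl y>y
xyyxy-monotone-split 1 (suc (suc _))       _ ((y<y ∷ _) ∷ _) _          = <-irrefl refl y<y
xyyxy-monotone-split 2 0                   _ _ ((_ ∷ y>y ∷ _) ∷ _)      = <-irrefl refl y>y
xyyxy-monotone-split 2 1 ((x<y ∷ []) ∷ _) _ ((y<x ∷ []) ∷ _)            = <-asym x<y y<x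
xyyxy-monotone-split 2 2 ((x<y ∷ []) ∷ _) ((y<x ∷ []) ∷ _) _            = <-asym x<y y<x
xyyxy-monotone-split 2 (suc (suc (suc _))) _ ((_ ∷ y<y ∷ _) ∷ _) _      = <-irrefl refl y<y

xyyxy-⊈-inc-inc-dec : ∀ {x y : ℕ} {xs ys zs} → AllPairs _<_ xs → AllPairs _<_ ys → AllPairs _>_ zs →
                      ¬ (x ∷ y ∷ y ∷ x ∷ y ∷ [] ⊆ xs ++ ys ++ zs)
xyyxy-⊈-inc-inc-dec inc₁ inc₂ dec s with split-⊆-++ s
... | k , s₁ , s₂₃ with split-⊆-++ s₂₃
... | l , s₂ , s₃ =
  xyyxy-monotone-split k l (AllPairs-resp-⊆ s₁ inc₁) (AllPairs-resp-⊆ s₂ inc₂) (AllPairs-resp-⊆ s₃ dec)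

incIncDec : ℕ → List (List ℕ)
incIncDec r = upTo r ∷ upTo r ∷ reverse (upTo r) ∷ []

incIncDec-formation : ∀ r → IsFormation r 3 (concat (incIncDec r))
incIncDec-formation r =
  upTo r , length-upTo r , upTo⁺ r , incIncDec r , refl , ↭-refl ∷ ↭-refl ∷ ↭-reverse (upTo r) ∷ [] , refl

incIncDec-avoids : ∀ r n → 2 ≤ n → ¬ Contains (concat (incIncDec r)) (pattern-u n)
incIncDec-avoids r (suc zero)    (s≤s ())
incIncDec-avoids r (suc (suc k)) _ contains with contains-xyyxy (Contains-⊆ʳ (xyyxy⊆pattern-u k) contains)
... | _ , _ , s = xyyxy-⊈-inc-inc-dec increasing increasing
                    (subst (AllPairs _>_) (sym (++-identityʳ _)) (AllPairs-reverse⁺ increasing)) s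
  where
  increasing : AllPairs _<_ (upTo r)
  increasing = AllPairs.applyUpTo⁺₁ id r (λ i<j _ → i<j)

formation-prefix : ∀ {r s s′ f} → s ≤ s′ → IsFormation r s′ f → ∃ λ f′ → f′ ⊆ f × IsFormation r s f′
formation-prefix {s = s} s≤s′ (base , |base| , ubase , blocks , refl , perms , refl) =
  concat (take s blocks) , concat-take-⊆ s blocks ,
  base , |base| , ubase , take s blocks , trans (length-take s blocks) (m≤n⇒m⊓n≡m s≤s′) ,
  All.take⁺ s perms , refl

fw-lower : ∀ n → 2 ≤ n → ∀ s → FwAdmissible (pattern-u n) s → 4 ≤ s
fw-lower n 2≤n s (r , contains) with 4 ≤? s
... | yes 4≤s = 4≤s
... | no  4≰s with formation-prefix (s≤s⁻¹ (≰⇒> 4≰s)) (incIncDec-formation r)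
... | f , f⊆ , formation = ⊥-elim (incIncDec-avoids r n 2≤n (Contains-⊆ˡ f⊆ (contains f formation)))

corollary11 : (n : ℕ) → 3 ≤ n → FwIs (pattern-u n) 4
corollary11 n 3≤n = fw-upper n 3≤n , fw-lower n (≤-trans (n≤1+n 2) 3≤n)
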